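{- Let $k\in\mathbb{Z}$. Define the poly-Bell polynomials of the second kind $\mathrm{bel}_n^{(k)}(x)$ ($n\ge1$) by \[ \mathrm{Li}_{k}\big(-x\log(1-t)\big)=\sum_{n=1}^{\infty}\mathrm{bel}_{n}^{(k)}(x)\frac{t^{n}}{n!}, \] and the poly-Bell numbers of the second kind by $\mathrm{bel}_n^{(k)}=\mathrm{bel}_n^{(k)}(1)$. Then for every $n\ge1$, \[ \mathrm{bel}_{n}^{(k)}(x)=\sum_{l=1}^{n}\frac{x^{l}}{l^{k-1}}(l-1)!{n \brack l}, \] and in particular \[ \mathrm{bel}_{n}^{(k)}=\sum_{l=1}^{n}\frac{1}{l^{k-1}}(l-1)!{n \brack l}. \]
   Context: The polylogarithm of index $k\in\mathbb{Z}$ is $\mathrm{Li}_{k}(x)=\sum_{n=1}^{\infty}\frac{x^{n}}{n^{k}}$ (as a formal power series). The unsigned Stirling numbers of the first kind ${n\brack l}$ are given by $\frac{1}{l!}\big(-\log(1-t)\big)^l=\sum_{n\ge l}{n\brack l}\frac{t^n}{n!}$. -}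

module Defs where

open import Data.Nat as ℕ using (ℕ; zero; suc; _∸_)
open import Data.Nat.Properties using (m^n≢0)
open import Data.Nat using (_!)
open import Data.Integer as ℤ using (ℤ; +_; -[1+_])
open import Data.Rational as ℚ using (ℚ; 0ℚ; 1ℚ; _+_; _*_; -_; _/_)

_^ℚ_ : ℚ → ℕ → ℚ
q ^ℚ zero  = 1ℚ
q ^ℚ suc m = q * (q ^ℚ m)

-- The rational number 1 / (suc j)^e for an integer exponent e,
-- i.e. (suc j)^(-e).
invPow : ℕ → ℤ → ℚ
invPow j (+ m)     = _/_ (+ 1) (suc j ℕ.^ m) {{m^n≢0 (suc j) m}}
invPow j -[1+ m ]  = (+ (suc j ℕ.^ suc m)) / 1

sum0 : ℕ → (ℕ → ℚ) → ℚ
sum0 zero    f = f 0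
sum0 (suc n) f = sum0 n f + f (suc n)

sum1 : ℕ → (ℕ → ℚ) → ℚ
sum1 zero    f = 0ℚ
sum1 (suc n) f = sum1 n f + f (suc n)

FPS : Set
FPS = ℕ → ℚ

oneS : FPS
oneS zero    = 1ℚ
oneS (suc _) = 0ℚ

_⊛_ : FPS → FPS → FPS
(f ⊛ g) n = sum0 n (λ i → f i * g (n ∸ i))

powS : FPS → ℕ → FPS
powS f zero    = oneS
powS f (suc m) = f ⊛ powS f m

-- -log(1 - t) = Σ_{m ≥ 1} t^m / m
negLog1m : FPS
negLog1m zero    = 0ℚ
negLog1m (suc m) = (+ 1) / suc m

scaleS : ℚ → FPS → FPS
scaleS x f n = x * f n

-- Li_k(g(t)) for a series g with zero constant term:
-- Li_k(g) = Σ_{m ≥ 1} g^m / m^k; the coefficient of t^N only receives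
-- contributions from m ≤ N (standard definition of composition).
LiComp : ℤ → FPS → FPS
LiComp k g N = sum1 N (λ m → invPow (m ∸ 1) k * powS g m N)

-- poly-Bell polynomial of the second kind, evaluated at x ∈ ℚ:
-- Li_k(-x log(1-t)) = Σ_{n ≥ 1} bel k x n · t^n / n!
bel : ℤ → ℚ → ℕ → ℚ
bel k x n = ((+ (n !)) / 1) * LiComp k (scaleS x negLog1m) n

belNum : ℤ → ℕ → ℚ
belNum k n = bel k 1ℚ n

stirling1 : ℕ → ℕ → ℕ
stirling1 zero    zero    = 1
stirling1 zero    (suc l) = 0
stirling1 (suc n) zero    = 0
stirling1 (suc n) (suc l) = n ℕ.* stirling1 n (suc l) ℕ.+ stirling1 n l

{-# OPTIONS --safe #-}
-- With L = -log(1-t) we have Li_k(xL) = Σ_m x^m L^m / m^k, so everything reduces to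
-- n! [tⁿ] L^m = m! [n, m].  Since (1-t) L' = 1, the Leibniz rule gives
-- (1-t) (L^m)' = m L^(m-1); comparing coefficients of t^N yields
-- (N+1) [t^(N+1)] L^(m+1) = N [t^N] L^(m+1) + (m+1) [t^N] L^m, which after multiplying
-- by N! is the defining recurrence of the Stirling numbers of the first kind.
-- Finally m! / m^k = (m-1)! / m^(k-1).
module Submission where

open import Defs
open import Data.Empty using (⊥-elim-irr)
open import Data.Nat as ℕ using (ℕ; zero; suc; _≤_; _∸_; z≤n)
open import Data.Nat using (_!)
import Data.Nat.Properties as ℕP
open import Data.Nat.Tactic.RingSolver using (solve-∀)
open import Data.Integer as ℤ using (ℤ; +_; -[1+_])
import Data.Integer.Properties as ℤP
open import Data.Rational as ℚ using (ℚ; _*_; _/_; _+_; _-_; 0ℚ; 1ℚ; toℚᵘ)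
import Data.Rational.Properties as ℚP
import Data.Rational.Unnormalised as ℚᵘ
import Data.Rational.Unnormalised.Properties as ℚᵘP
open import Data.Rational.Solver using (module +-*-Solver)
open import Data.Product using (_×_; _,_)
open import Relation.Binary.PropositionalEquality
open +-*-Solver

module _ where
  open ℚᵘP.≃-Reasoning

  toℚᵘ-/ : ∀ i n .{{_ : ℕ.NonZero n}} → toℚᵘ (i / n) ℚᵘ.≃ ℚᵘ.mkℚᵘ i (ℕ.pred n)
  toℚᵘ-/ i zero {{n≢0}} = ⊥-elim-irr (ℕ.NonZero.nonZero n≢0)
  toℚᵘ-/ i (suc n)      = ℚP.toℚᵘ-fromℚᵘ (ℚᵘ.mkℚᵘ i n)

  /-*-/ : ∀ i j m n .{{_ : ℕ.NonZero m}} .{{_ : ℕ.NonZero n}} →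
          (i / m) * (j / n) ≡ _/_ (i ℤ.* j) (m ℕ.* n) {{ℕP.m*n≢0 m n}}
  /-*-/ i j (suc m) (suc n) = ℚP.toℚᵘ-injective (begin
    toℚᵘ ((i / suc m) * (j / suc n))           ≈⟨ ℚP.toℚᵘ-homo-* (i / suc m) (j / suc n) ⟩
    toℚᵘ (i / suc m) ℚᵘ.* toℚᵘ (j / suc n)     ≈⟨ ℚᵘP.*-cong (toℚᵘ-/ i (suc m)) (toℚᵘ-/ j (suc n)) ⟩
    ℚᵘ.mkℚᵘ (i ℤ.* j) (ℕ.pred (suc m ℕ.* suc n)) ≈⟨ toℚᵘ-/ (i ℤ.* j) (suc m ℕ.* suc n) ⟨
    toℚᵘ ((i ℤ.* j) / (suc m ℕ.* suc n))       ∎)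

  /1-+-/1 : ∀ i j → (i / 1) + (j / 1) ≡ (i ℤ.+ j) / 1
  /1-+-/1 i j = ℚP.toℚᵘ-injective (begin
    toℚᵘ ((i / 1) + (j / 1))             ≈⟨ ℚP.toℚᵘ-homo-+ (i / 1) (j / 1) ⟩
    toℚᵘ (i / 1) ℚᵘ.+ toℚᵘ (j / 1)       ≈⟨ ℚᵘP.+-cong (toℚᵘ-/ i 1) (toℚᵘ-/ j 1) ⟩
    ℚᵘ.mkℚᵘ (i ℤ.* + 1 ℤ.+ j ℤ.* + 1) 0  ≈⟨ ℚᵘ.*≡* (cong (ℤ._* + 1) (cong₂ ℤ._+_ (ℤP.*-identityʳ i) (ℤP.*-identityʳ j))) ⟩
    ℚᵘ.mkℚᵘ (i ℤ.+ j) 0                  ≈⟨ toℚᵘ-/ (i ℤ.+ j) 1 ⟨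
    toℚᵘ ((i ℤ.+ j) / 1)                 ∎)

  +/-*-+/ : ∀ a b m n .{{_ : ℕ.NonZero m}} .{{_ : ℕ.NonZero n}} →
            (+ a / m) * (+ b / n) ≡ _/_ (+ (a ℕ.* b)) (m ℕ.* n) {{ℕP.m*n≢0 m n}}
  +/-*-+/ a b m n = trans (/-*-/ (+ a) (+ b) m n) (cong (λ z → _/_ z (m ℕ.* n) {{ℕP.m*n≢0 m n}}) (sym (ℤP.pos-* a b)))

  +/≡+/ : ∀ a b m n .{{_ : ℕ.NonZero m}} .{{_ : ℕ.NonZero n}} →
          a ℕ.* n ≡ b ℕ.* m → + a / m ≡ + b / n
  +/≡+/ a b (suc m) (suc n) eq = ℚP.toℚᵘ-injective (begin
    toℚᵘ (+ a / suc m)  ≈⟨ toℚᵘ-/ (+ a) (suc m) ⟩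
    ℚᵘ.mkℚᵘ (+ a) m     ≈⟨ ℚᵘ.*≡* (trans (sym (ℤP.pos-* a (suc n))) (trans (cong +_ eq) (ℤP.pos-* b (suc m)))) ⟩
    ℚᵘ.mkℚᵘ (+ b) n     ≈⟨ toℚᵘ-/ (+ b) (suc n) ⟨
    toℚᵘ (+ b / suc n)  ∎)

open ≡-Reasoning

ι : ℕ → ℚ
ι n = + n / 1

ι-+ : ∀ a b → ι (a ℕ.+ b) ≡ ι a + ι b
ι-+ a b = trans (cong (_/ 1) (ℤP.pos-+ a b)) (sym (/1-+-/1 (+ a) (+ b)))

ι-* : ∀ a b → ι (a ℕ.* b) ≡ ι a * ι b
ι-* a b = sym (+/-*-+/ a b 1 1)

ι-*-1/ : ∀ d → ι (suc d) * (+ 1 / suc d) ≡ 1ℚ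
ι-*-1/ d = trans (+/-*-+/ (suc d) 1 1 (suc d)) (+/≡+/ (suc d ℕ.* 1) 1 (1 ℕ.* suc d) 1 (cross d))
  where
  cross : ∀ d → suc d ℕ.* 1 ℕ.* 1 ≡ 1 ℕ.* (1 ℕ.* suc d)
  cross = solve-∀

invPow-*-suc : ∀ j k → invPow j k * ι (suc j) ≡ invPow j (k ℤ.- + 1)
invPow-*-suc j (+ zero) = trans (+/-*-+/ 1 (suc j) 1 1) (+/≡+/ (1 ℕ.* suc j) (suc j ℕ.^ 1) 1 1 (cross (suc j)))
  where
  cross : ∀ x → 1 ℕ.* x ℕ.* 1 ≡ x ℕ.* 1 ℕ.* (1 ℕ.* 1)
  cross = solve-∀
invPow-*-suc j (+ suc m) =
  trans (+/-*-+/ 1 (suc j) (suc j ℕ.^ suc m) 1 {{ℕP.m^n≢0 (suc j) (suc m)}})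
        (+/≡+/ (1 ℕ.* suc j) 1 (suc j ℕ.^ suc m ℕ.* 1) (suc j ℕ.^ m) {{ℕP.m*n≢0 (suc j ℕ.^ suc m) 1 {{ℕP.m^n≢0 (suc j) (suc m)}}}} {{ℕP.m^n≢0 (suc j) m}} (cross (suc j) (suc j ℕ.^ m)))
  where
  cross : ∀ x y → 1 ℕ.* x ℕ.* y ≡ 1 ℕ.* (x ℕ.* y ℕ.* 1)
  cross = solve-∀
invPow-*-suc j -[1+ m ] = trans (+/-*-+/ (suc j ℕ.^ suc m) (suc j) 1 1) (+/≡+/ (suc j ℕ.^ suc m ℕ.* suc j) (suc j ℕ.^ suc (suc (m ℕ.+ 0))) 1 1 cross)
  where
  cross : suc j ℕ.^ suc m ℕ.* suc j ℕ.* 1 ≡ suc j ℕ.^ suc (suc (m ℕ.+ 0)) ℕ.* 1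
  cross = cong (ℕ._* 1) (trans (ℕP.*-comm _ (suc j)) (cong (λ e → suc j ℕ.^ suc (suc e)) (sym (ℕP.+-identityʳ m))))

sum0-cong : ∀ n {f g : ℕ → ℚ} → (∀ i → i ≤ n → f i ≡ g i) → sum0 n f ≡ sum0 n g
sum0-cong zero    f≡g = f≡g 0 z≤n
sum0-cong (suc n) f≡g = cong₂ _+_ (sum0-cong n (λ i i≤n → f≡g i (ℕP.m≤n⇒m≤1+n i≤n))) (f≡g (suc n) ℕP.≤-refl)

sum0-+ : ∀ n (f g : ℕ → ℚ) → sum0 n (λ i → f i + g i) ≡ sum0 n f + sum0 n g
sum0-+ zero    f g = refl
sum0-+ (suc n) f g = trans (cong (_+ (f (suc n) + g (suc n))) (sum0-+ n f g))
  (solve 4 (λ a b c d → (a :+ b) :+ (c :+ d) := (a :+ c) :+ (b :+ d)) refl (sum0 n f) (sum0 n g) (f (suc n)) (g (suc n)))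

sum0-- : ∀ n (f g : ℕ → ℚ) → sum0 n (λ i → f i - g i) ≡ sum0 n f - sum0 n g
sum0-- zero    f g = refl
sum0-- (suc n) f g = trans (cong (_+ (f (suc n) - g (suc n))) (sum0-- n f g))
  (solve 4 (λ a b c d → (a :- b) :+ (c :- d) := (a :+ c) :- (b :+ d)) refl (sum0 n f) (sum0 n g) (f (suc n)) (g (suc n)))

sum0-*ˡ : ∀ n c (f : ℕ → ℚ) → sum0 n (λ i → c * f i) ≡ c * sum0 n f
sum0-*ˡ zero    c f = refl
sum0-*ˡ (suc n) c f = trans (cong (_+ (c * f (suc n))) (sum0-*ˡ n c f)) (sym (ℚP.*-distribˡ-+ c (sum0 n f) (f (suc n))))

sum0-suc : ∀ n (f : ℕ → ℚ) → sum0 (suc n) f ≡ f 0 + sum0 n (λ i → f (suc i))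
sum0-suc zero    f = refl
sum0-suc (suc n) f = trans (cong (_+ f (suc (suc n))) (sum0-suc n f)) (ℚP.+-assoc (f 0) _ _)

sum1-cong : ∀ n {f g : ℕ → ℚ} → (∀ m → f (suc m) ≡ g (suc m)) → sum1 n f ≡ sum1 n g
sum1-cong zero    f≡g = refl
sum1-cong (suc n) f≡g = cong₂ _+_ (sum1-cong n f≡g) (f≡g n)

sum1-*ˡ : ∀ n c (f : ℕ → ℚ) → c * sum1 n f ≡ sum1 n (λ m → c * f m)
sum1-*ˡ zero    c f = ℚP.*-zeroʳ c
sum1-*ˡ (suc n) c f = trans (ℚP.*-distribˡ-+ c (sum1 n f) (f (suc n))) (cong (_+ (c * f (suc n))) (sum1-*ˡ n c f))

infix 4 _≐_
_≐_ : FPS → FPS → Set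
f ≐ g = ∀ n → f n ≡ g n

infixl 6 _⊕_
_⊕_ : FPS → FPS → FPS
(f ⊕ g) n = f n + g n

infixr 25 ∂_ [1-t]·_
∂_ : FPS → FPS
(∂ f) n = ι (suc n) * f (suc n)

[1-t]·_ : FPS → FPS
([1-t]· f) zero    = f 0
([1-t]· f) (suc n) = f (suc n) - f n

[1-t]·-cong : ∀ {f g} → f ≐ g → [1-t]· f ≐ [1-t]· g
[1-t]·-cong f≐g zero    = f≐g 0
[1-t]·-cong f≐g (suc n) = cong₂ _-_ (f≐g (suc n)) (f≐g n)

[1-t]·-⊕ : ∀ f g → [1-t]· (f ⊕ g) ≐ [1-t]· f ⊕ [1-t]· g
[1-t]·-⊕ f g zero    = refl
[1-t]·-⊕ f g (suc n) =
  solve 4 (λ a b c d → (a :+ b) :- (c :+ d) := (a :- c) :+ (b :- d)) refl (f (suc n)) (g (suc n)) (f n) (g n)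

⊛-congˡ : ∀ {f g} h → f ≐ g → f ⊛ h ≐ g ⊛ h
⊛-congˡ h f≐g n = sum0-cong n (λ i _ → cong (_* h (n ∸ i)) (f≐g i))

⊛-congʳ : ∀ f {g h} → g ≐ h → f ⊛ g ≐ f ⊛ h
⊛-congʳ f g≐h n = sum0-cong n (λ i _ → cong (f i *_) (g≐h (n ∸ i)))

⊛-scaleSʳ : ∀ f c g → f ⊛ scaleS c g ≐ scaleS c (f ⊛ g)
⊛-scaleSʳ f c g n = trans
  (sum0-cong n (λ i _ → solve 3 (λ a b d → a :* (b :* d) := b :* (a :* d)) refl (f i) c (g (n ∸ i))))
  (sum0-*ˡ n c (λ i → f i * g (n ∸ i)))

⊛-identityˡ : ∀ f → oneS ⊛ f ≐ f
⊛-identityˡ f zero    = ℚP.*-identityˡ (f 0)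
⊛-identityˡ f (suc n) = begin
  (oneS ⊛ f) (suc n)                                    ≡⟨ sum0-suc n (λ i → oneS i * f (suc n ∸ i)) ⟩
  1ℚ * f (suc n) + sum0 n (λ i → 0ℚ * f (n ∸ i))        ≡⟨ cong₂ _+_ (ℚP.*-identityˡ (f (suc n))) (sum0-*ˡ n 0ℚ (λ i → f (n ∸ i))) ⟩
  f (suc n) + 0ℚ * sum0 n (λ i → f (n ∸ i))             ≡⟨ cong (_+_ (f (suc n))) (ℚP.*-zeroˡ (sum0 n (λ i → f (n ∸ i)))) ⟩
  f (suc n) + 0ℚ                                        ≡⟨ ℚP.+-identityʳ _ ⟩
  f (suc n)                                             ∎

∂-⊛ : ∀ f g → ∂ (f ⊛ g) ≐ ∂ f ⊛ g ⊕ f ⊛ ∂ g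
∂-⊛ f g n = begin
  ι (suc n) * sum0 (suc n) (λ i → f i * g (suc n ∸ i))  ≡⟨ sym (sum0-*ˡ (suc n) (ι (suc n)) _) ⟩
  sum0 (suc n) (λ i → ι (suc n) * (f i * g (suc n ∸ i))) ≡⟨ sum0-cong (suc n) split ⟩
  sum0 (suc n) (λ i → A i + B i)                        ≡⟨ sum0-+ (suc n) A B ⟩
  sum0 (suc n) A + sum0 (suc n) B                       ≡⟨ cong₂ _+_ sumA sumB ⟩
  (∂ f ⊛ g) n + (f ⊛ ∂ g) n                             ∎
  where
  A B : ℕ → ℚ
  A i = (ι i * f i) * g (suc n ∸ i)
  B i = f i * (ι (suc n ∸ i) * g (suc n ∸ i))

  split : ∀ i → i ≤ suc n → ι (suc n) * (f i * g (suc n ∸ i)) ≡ A i + B i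
  split i i≤1+n = begin
    ι (suc n) * (f i * g (suc n ∸ i))               ≡⟨ cong (λ z → ι z * (f i * g (suc n ∸ i))) (sym (ℕP.m+[n∸m]≡n i≤1+n)) ⟩
    ι (i ℕ.+ (suc n ∸ i)) * (f i * g (suc n ∸ i))   ≡⟨ cong (_* (f i * g (suc n ∸ i))) (ι-+ i (suc n ∸ i)) ⟩
    (ι i + ι (suc n ∸ i)) * (f i * g (suc n ∸ i))   ≡⟨ solve 4 (λ a b c d → (a :+ b) :* (c :* d) := (a :* c) :* d :+ c :* (b :* d)) refl
                                                          (ι i) (ι (suc n ∸ i)) (f i) (g (suc n ∸ i)) ⟩
    A i + B i                                       ∎

  sumA : sum0 (suc n) A ≡ (∂ f ⊛ g) n
  sumA = begin
    sum0 (suc n) A                         ≡⟨ sum0-suc n A ⟩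
    (0ℚ * f 0) * g (suc n) + (∂ f ⊛ g) n   ≡⟨ cong (λ z → z * g (suc n) + (∂ f ⊛ g) n) (ℚP.*-zeroˡ (f 0)) ⟩
    0ℚ * g (suc n) + (∂ f ⊛ g) n           ≡⟨ cong (_+ (∂ f ⊛ g) n) (ℚP.*-zeroˡ (g (suc n))) ⟩
    0ℚ + (∂ f ⊛ g) n                       ≡⟨ ℚP.+-identityˡ _ ⟩
    (∂ f ⊛ g) n                            ∎

  sumB : sum0 (suc n) B ≡ (f ⊛ ∂ g) n
  sumB = begin
    sum0 n B + B (suc n)                    ≡⟨ cong₂ _+_ (sum0-cong n (λ i i≤n → cong (λ z → f i * (ι z * g z)) (ℕP.+-∸-assoc 1 i≤n))) lastB ⟩
    (f ⊛ ∂ g) n + 0ℚ                        ≡⟨ ℚP.+-identityʳ _ ⟩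
    (f ⊛ ∂ g) n                             ∎
    where
    lastB : B (suc n) ≡ 0ℚ
    lastB = begin
      f (suc n) * (ι (suc n ∸ suc n) * g (suc n ∸ suc n))  ≡⟨ cong (λ z → f (suc n) * (ι z * g z)) (ℕP.n∸n≡0 n) ⟩
      f (suc n) * (0ℚ * g 0)                                ≡⟨ cong (f (suc n) *_) (ℚP.*-zeroˡ (g 0)) ⟩
      f (suc n) * 0ℚ                                        ≡⟨ ℚP.*-zeroʳ (f (suc n)) ⟩
      0ℚ                                                    ∎

[1-t]·-⊛ˡ : ∀ f g → [1-t]· (f ⊛ g) ≐ ([1-t]· f) ⊛ g
[1-t]·-⊛ˡ f g zero    = refl
[1-t]·-⊛ˡ f g (suc n) = begin
  sum0 (suc n) (λ i → f i * g (suc n ∸ i)) - Q  ≡⟨ cong (_- Q) (sum0-suc n _) ⟩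
  (f 0 * g (suc n) + P) - Q                     ≡⟨ solve 3 (λ a p q → (a :+ p) :- q := a :+ (p :- q)) refl (f 0 * g (suc n)) P Q ⟩
  f 0 * g (suc n) + (P - Q)                     ≡⟨ cong (_+_ (f 0 * g (suc n))) (sym (sum0-- n _ _)) ⟩
  f 0 * g (suc n) + sum0 n (λ i → f (suc i) * g (n ∸ i) - f i * g (n ∸ i))
    ≡⟨ cong (_+_ (f 0 * g (suc n))) (sum0-cong n (λ i _ →
         solve 3 (λ a b c → a :* c :- b :* c := (a :- b) :* c) refl (f (suc i)) (f i) (g (n ∸ i)))) ⟩
  f 0 * g (suc n) + sum0 n (λ i → ([1-t]· f) (suc i) * g (n ∸ i))
    ≡⟨ sym (sum0-suc n (λ i → ([1-t]· f) i * g (suc n ∸ i))) ⟩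
  (([1-t]· f) ⊛ g) (suc n)                      ∎
  where
  P = sum0 n (λ i → f (suc i) * g (n ∸ i))
  Q = sum0 n (λ i → f i * g (n ∸ i))

[1-t]·-⊛ʳ : ∀ f g → [1-t]· (f ⊛ g) ≐ f ⊛ [1-t]· g
[1-t]·-⊛ʳ f g zero    = refl
[1-t]·-⊛ʳ f g (suc n) = begin
  (sum0 n (λ i → f i * g (suc n ∸ i)) + f (suc n) * g (suc n ∸ suc n)) - Q
    ≡⟨ cong₂ (λ s z → (s + f (suc n) * g z) - Q)
         (sum0-cong n (λ i i≤n → cong (λ z → f i * g z) (ℕP.+-∸-assoc 1 i≤n))) (ℕP.n∸n≡0 n) ⟩
  (P + f (suc n) * g 0) - Q
    ≡⟨ solve 3 (λ p a q → (p :+ a) :- q := (p :- q) :+ a) refl P (f (suc n) * g 0) Q ⟩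
  (P - Q) + f (suc n) * g 0
    ≡⟨ cong (_+ (f (suc n) * g 0)) (sym (sum0-- n _ _)) ⟩
  sum0 n (λ i → f i * g (suc (n ∸ i)) - f i * g (n ∸ i)) + f (suc n) * g 0
    ≡⟨ cong (_+ (f (suc n) * g 0)) (sum0-cong n (λ i i≤n → trans
         (solve 3 (λ a b c → a :* b :- a :* c := a :* (b :- c)) refl (f i) (g (suc (n ∸ i))) (g (n ∸ i)))
         (cong (λ z → f i * ([1-t]· g) z) (sym (ℕP.+-∸-assoc 1 i≤n))))) ⟩
  sum0 n (λ i → f i * ([1-t]· g) (suc n ∸ i)) + f (suc n) * ([1-t]· g) 0
    ≡⟨ cong (λ z → sum0 n (λ i → f i * ([1-t]· g) (suc n ∸ i)) + f (suc n) * ([1-t]· g) z) (sym (ℕP.n∸n≡0 n)) ⟩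
  (f ⊛ [1-t]· g) (suc n) ∎
  where
  P = sum0 n (λ i → f i * g (suc (n ∸ i)))
  Q = sum0 n (λ i → f i * g (n ∸ i))

powS-scaleS : ∀ x f m → powS (scaleS x f) m ≐ scaleS (x ^ℚ m) (powS f m)
powS-scaleS x f zero    N = sym (ℚP.*-identityˡ (oneS N))
powS-scaleS x f (suc m) N = begin
  sum0 N (λ i → (x * f i) * powS (scaleS x f) m (N ∸ i))
    ≡⟨ sum0-cong N (λ i _ → trans (cong ((x * f i) *_) (powS-scaleS x f m (N ∸ i)))
         (solve 4 (λ x f y p → (x :* f) :* (y :* p) := (x :* y) :* (f :* p)) refl x (f i) (x ^ℚ m) (powS f m (N ∸ i)))) ⟩
  sum0 N (λ i → (x * (x ^ℚ m)) * (f i * powS f m (N ∸ i)))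
    ≡⟨ sum0-*ˡ N (x * (x ^ℚ m)) (λ i → f i * powS f m (N ∸ i)) ⟩
  (x * (x ^ℚ m)) * (f ⊛ powS f m) N ∎

⊛-powS-pred : ∀ f l → scaleS (ι l) (f ⊛ powS f (l ∸ 1)) ≐ scaleS (ι l) (powS f l)
⊛-powS-pred f zero    n = trans (ℚP.*-zeroˡ ((f ⊛ oneS) n)) (sym (ℚP.*-zeroˡ (oneS n)))
⊛-powS-pred f (suc l) n = refl

[1-t]·∂-powS : ∀ f → [1-t]· ∂ f ≐ oneS → ∀ l → [1-t]· ∂ powS f l ≐ scaleS (ι l) (powS f (l ∸ 1))
[1-t]·∂-powS f hf zero    zero    = refl
[1-t]·∂-powS f hf zero    (suc n) = cong₂ _-_ (ℚP.*-zeroʳ (ι (suc (suc n)))) (ℚP.*-zeroʳ (ι (suc n)))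
[1-t]·∂-powS f hf (suc l) n = begin
  ([1-t]· ∂ (f ⊛ M)) n                                 ≡⟨ [1-t]·-cong (∂-⊛ f M) n ⟩
  ([1-t]· (∂ f ⊛ M ⊕ f ⊛ ∂ M)) n                       ≡⟨ [1-t]·-⊕ (∂ f ⊛ M) (f ⊛ ∂ M) n ⟩
  ([1-t]· (∂ f ⊛ M)) n + ([1-t]· (f ⊛ ∂ M)) n          ≡⟨ cong₂ _+_ ([1-t]·-⊛ˡ (∂ f) M n) ([1-t]·-⊛ʳ f (∂ M) n) ⟩
  ([1-t]· ∂ f ⊛ M) n + (f ⊛ [1-t]· ∂ M) n              ≡⟨ cong₂ _+_ (⊛-congˡ M hf n) (⊛-congʳ f ([1-t]·∂-powS f hf l) n) ⟩
  (oneS ⊛ M) n + (f ⊛ scaleS (ι l) (powS f (l ∸ 1))) n ≡⟨ cong₂ _+_ (⊛-identityˡ M n) (⊛-scaleSʳ f (ι l) (powS f (l ∸ 1)) n) ⟩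
  M n + ι l * (f ⊛ powS f (l ∸ 1)) n                   ≡⟨ cong (_+_ (M n)) (⊛-powS-pred f l n) ⟩
  M n + ι l * M n                                      ≡⟨ solve 2 (λ m x → m :+ x :* m := (con 1ℚ :+ x) :* m) refl (M n) (ι l) ⟩
  (1ℚ + ι l) * M n                                     ≡⟨ cong (_* M n) (sym (ι-+ 1 l)) ⟩
  ι (suc l) * M n                                      ∎
  where
  M = powS f l

powS-coeff-suc : ∀ f → [1-t]· ∂ f ≐ oneS → ∀ l N →
  ι (suc N) * powS f (suc l) (suc N) ≡ ι N * powS f (suc l) N + ι (suc l) * powS f l N
powS-coeff-suc f hf l zero    = trans ([1-t]·∂-powS f hf (suc l) 0)
  (sym (trans (cong (_+ (ι (suc l) * powS f l 0)) (ℚP.*-zeroˡ (powS f (suc l) 0))) (ℚP.+-identityˡ _)))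
powS-coeff-suc f hf l (suc n) =
  trans (solve 2 (λ x y → x := y :+ (x :- y)) refl X Y) (cong (_+_ Y) ([1-t]·∂-powS f hf (suc l) (suc n)))
  where
  X = ι (suc (suc n)) * powS f (suc l) (suc (suc n))
  Y = ι (suc n) * powS f (suc l) (suc n)

[1-t]·∂-negLog1m : [1-t]· ∂ negLog1m ≐ oneS
[1-t]·∂-negLog1m zero    = ι-*-1/ 0
[1-t]·∂-negLog1m (suc n) = cong₂ _-_ (ι-*-1/ (suc n)) (ι-*-1/ n)

negLog1m-powS-stirling1 : ∀ N l → ι (N !) * powS negLog1m l N ≡ ι (l !) * ι (stirling1 N l)
negLog1m-powS-stirling1 zero    zero    = refl
negLog1m-powS-stirling1 zero    (suc l) = trans (cong (ι 1 *_) (ℚP.*-zeroˡ (powS negLog1m l 0)))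
  (trans (ℚP.*-zeroʳ (ι 1)) (sym (ℚP.*-zeroʳ (ι (suc l !)))))
negLog1m-powS-stirling1 (suc N) zero    = ℚP.*-zeroʳ (ι (suc N !))
negLog1m-powS-stirling1 (suc N) (suc l) = begin
  ι (suc N ℕ.* N !) * a (suc l) (suc N)
    ≡⟨ cong (_* a (suc l) (suc N)) (ι-* (suc N) (N !)) ⟩
  (ι (suc N) * ι (N !)) * a (suc l) (suc N)
    ≡⟨ solve 3 (λ x y z → (x :* y) :* z := y :* (x :* z)) refl (ι (suc N)) (ι (N !)) (a (suc l) (suc N)) ⟩
  ι (N !) * (ι (suc N) * a (suc l) (suc N))
    ≡⟨ cong (ι (N !) *_) (powS-coeff-suc negLog1m [1-t]·∂-negLog1m l N) ⟩
  ι (N !) * (ι N * a (suc l) N + ι (suc l) * a l N)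
    ≡⟨ solve 5 (λ f n b s c → f :* (n :* b :+ s :* c) := n :* (f :* b) :+ s :* (f :* c)) refl
         (ι (N !)) (ι N) (a (suc l) N) (ι (suc l)) (a l N) ⟩
  ι N * (ι (N !) * a (suc l) N) + ι (suc l) * (ι (N !) * a l N)
    ≡⟨ cong₂ (λ u v → ι N * u + ι (suc l) * v) (negLog1m-powS-stirling1 N (suc l)) (negLog1m-powS-stirling1 N l) ⟩
  ι N * (ι (suc l ℕ.* l !) * ι s₁) + ι (suc l) * (ι (l !) * ι s₀)
    ≡⟨ cong (λ z → ι N * (z * ι s₁) + ι (suc l) * (ι (l !) * ι s₀)) (ι-* (suc l) (l !)) ⟩
  ι N * ((ι (suc l) * ι (l !)) * ι s₁) + ι (suc l) * (ι (l !) * ι s₀)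
    ≡⟨ solve 5 (λ n s f x y → n :* ((s :* f) :* x) :+ s :* (f :* y) := (s :* f) :* (n :* x :+ y)) refl
         (ι N) (ι (suc l)) (ι (l !)) (ι s₁) (ι s₀) ⟩
  (ι (suc l) * ι (l !)) * (ι N * ι s₁ + ι s₀)
    ≡⟨ sym (cong₂ _*_ (ι-* (suc l) (l !)) (trans (ι-+ (N ℕ.* s₁) s₀) (cong (_+ ι s₀) (ι-* N s₁)))) ⟩
  ι (suc l ℕ.* l !) * ι (N ℕ.* s₁ ℕ.+ s₀) ∎
  where
  a = powS negLog1m
  s₁ = stirling1 N (suc l)
  s₀ = stirling1 N l

^ℚ-zeroˡ : ∀ l → 1ℚ ^ℚ l ≡ 1ℚ
^ℚ-zeroˡ zero    = refl
^ℚ-zeroˡ (suc l) = trans (ℚP.*-identityˡ (1ℚ ^ℚ l)) (^ℚ-zeroˡ l)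

bel-stirling1 : ∀ k n x → bel k x n ≡
  sum1 n (λ l → (x ^ℚ l) * invPow (l ∸ 1) (k ℤ.- + 1) * ι ((l ∸ 1) !) * ι (stirling1 n l))
bel-stirling1 k n x = trans (sum1-*ˡ n (ι (n !)) _) (sum1-cong n summand)
  where
  summand : ∀ j → ι (n !) * (invPow j k * powS (scaleS x negLog1m) (suc j) n)
                ≡ (x ^ℚ suc j) * invPow j (k ℤ.- + 1) * ι (j !) * ι (stirling1 n (suc j))
  summand j = begin
    ι (n !) * (invPow j k * powS (scaleS x negLog1m) (suc j) n)
      ≡⟨ cong (λ z → ι (n !) * (invPow j k * z)) (powS-scaleS x negLog1m (suc j) n) ⟩
    ι (n !) * (invPow j k * (y * powS negLog1m (suc j) n))
      ≡⟨ solve 4 (λ f p y b → f :* (p :* (y :* b)) := (y :* p) :* (f :* b)) refl (ι (n !)) (invPow j k) y (powS negLog1m (suc j) n) ⟩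
    (y * invPow j k) * (ι (n !) * powS negLog1m (suc j) n)
      ≡⟨ cong ((y * invPow j k) *_) (negLog1m-powS-stirling1 n (suc j)) ⟩
    (y * invPow j k) * (ι (suc j ℕ.* j !) * ι s)
      ≡⟨ cong (λ z → (y * invPow j k) * (z * ι s)) (ι-* (suc j) (j !)) ⟩
    (y * invPow j k) * ((ι (suc j) * ι (j !)) * ι s)
      ≡⟨ solve 5 (λ y p q f t → (y :* p) :* ((q :* f) :* t) := y :* (p :* q) :* f :* t) refl y (invPow j k) (ι (suc j)) (ι (j !)) (ι s) ⟩
    y * (invPow j k * ι (suc j)) * ι (j !) * ι s
      ≡⟨ cong (λ z → y * z * ι (j !) * ι s) (invPow-*-suc j k) ⟩
    y * invPow j (k ℤ.- + 1) * ι (j !) * ι s ∎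
    where
    y = x ^ℚ suc j
    s = stirling1 n (suc j)

theorem8 : (k : ℤ) (n : ℕ) → 1 ≤ n →
    ((x : ℚ) → bel k x n ≡ sum1 n (λ l → (x ^ℚ l) * invPow (l ∸ 1) (k ℤ.- + 1) * ((+ ((l ∸ 1) !)) / 1) * ((+ stirling1 n l) / 1)))
    × (belNum k n ≡ sum1 n (λ l → invPow (l ∸ 1) (k ℤ.- + 1) * ((+ ((l ∸ 1) !)) / 1) * ((+ stirling1 n l) / 1)))
theorem8 k n _ = bel-stirling1 k n , (begin
  bel k 1ℚ n ≡⟨ bel-stirling1 k n 1ℚ ⟩
  sum1 n (λ l → (1ℚ ^ℚ l) * invPow (l ∸ 1) k′ * ι ((l ∸ 1) !) * ι (stirling1 n l))
    ≡⟨ sum1-cong n (λ j → cong (λ z → z * ι (j !) * ι (stirling1 n (suc j)))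
         (trans (cong (_* invPow j k′) (^ℚ-zeroˡ (suc j))) (ℚP.*-identityˡ (invPow j k′)))) ⟩
  sum1 n (λ l → invPow (l ∸ 1) k′ * ι ((l ∸ 1) !) * ι (stirling1 n l)) ∎)
  where
  k′ = k ℤ.- + 1
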